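{- Let $G$ be a graph of order $n$ with $r$ isolated vertices and let $m$ be a positive integer. The total domination polynomial of every graph in the family $\{G\circ \overline{K_m},\ (G\circ \overline{K_m})\circ \overline{K_m},\ ((G\circ \overline{K_m})\circ \overline{K_m})\circ \overline{K_m},\ldots\}$ is unimodal.
   Context: For graphs $G_1,G_2$, the corona $G_1\circ G_2$ is formed from one copy of $G_1$ and $|V(G_1)|$ copies of $G_2$, with the $i$-th vertex of $G_1$ joined to every vertex of the $i$-th copy of $G_2$; $\overline{K_m}$ is the edgeless graph on $m$ vertices. A set $D\subseteq V(G)$ is a total dominating set if every vertex is adjacent to some vertex of $D$; the total domination polynomial is $D_t(G,x)=\sum_i d_t(G,i)x^i$ with $d_t(G,i)$ the number of total dominating sets of size $i$. A polynomial $\sum_{k=0}^N a_kx^k$ is unimodal if for some index $j$, $a_0\le\cdots\le a_j\ge\cdots\ge a_N$. -}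

module Defs where

open import Data.Bool using (Bool; true; false; _∧_; _∨_; if_then_else_; T)
open import Data.Nat using (ℕ; zero; suc; _+_; _*_; _≤_; _<_)
open import Data.Fin using (Fin; splitAt; remQuot)
open import Data.Fin.Properties using (_≟_)
open import Data.Sum using (_⊎_; inj₁; inj₂)
open import Data.Product using (_×_; _,_; ∃-syntax)
open import Data.List using (List; []; _∷_; map; _++_; length; filter; allFin)
open import Data.Bool.ListAction using (all; any)
open import Data.Vec using (Vec; []; _∷_; lookup)
open import Relation.Nullary.Decidable using (⌊_⌋)
open import Relation.Nullary using (¬_)
open import Relation.Binary.PropositionalEquality using (_≡_)

record Graph : Set where
  field
    order : ℕ
    adj   : Fin order → Fin order → Bool
open Graph public

record IsSimple (G : Graph) : Set where
  field
    symmetric   : ∀ u v → adj G u v ≡ adj G v u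
    irreflexive : ∀ v → adj G v v ≡ false

IsIsolated : (G : Graph) → Fin (order G) → Set
IsIsolated G v = ∀ u → adj G v u ≡ false

-- Vertices of G ∘ K̄_m: Fin (n + n * m); the first n are the vertices of G,
-- the vertex (i , j) ∈ Fin n × Fin m is the j-th vertex of the i-th copy of K̄_m.
classify : ∀ n m → Fin (n + n * m) → Fin n ⊎ (Fin n × Fin m)
classify n m v with splitAt n v
... | inj₁ i = inj₁ i
... | inj₂ k = inj₂ (remQuot {n} m k)

coronaAdj : ∀ {n m} → (Fin n → Fin n → Bool) →
            Fin n ⊎ (Fin n × Fin m) → Fin n ⊎ (Fin n × Fin m) → Bool
coronaAdj a (inj₁ i) (inj₁ j) = a i j
coronaAdj a (inj₁ i) (inj₂ (j , _)) = ⌊ i ≟ j ⌋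
coronaAdj a (inj₂ (i , _)) (inj₁ j) = ⌊ i ≟ j ⌋
coronaAdj a (inj₂ _) (inj₂ _) = false

coronaK : Graph → ℕ → Graph
coronaK G m = record
  { order = order G + order G * m
  ; adj   = λ u v → coronaAdj (adj G) (classify (order G) m u) (classify (order G) m v)
  }

iterCorona : Graph → ℕ → ℕ → Graph
iterCorona G m zero    = G
iterCorona G m (suc t) = coronaK (iterCorona G m t) m

allSubsets : ∀ n → List (Vec Bool n)
allSubsets zero    = [] ∷ []
allSubsets (suc n) = map (true ∷_) (allSubsets n) ++ map (false ∷_) (allSubsets n)

size : ∀ {n} → Vec Bool n → ℕ
size []          = 0
size (true ∷ v)  = suc (size v)
size (false ∷ v) = size v

isTotalDominating : (G : Graph) → Vec Bool (order G) → Bool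
isTotalDominating G D =
  all (λ v → any (λ u → lookup D u ∧ adj G v u) (allFin (order G))) (allFin (order G))

dt : Graph → ℕ → ℕ
dt G i = length (filter (λ D → T? (isTotalDominating G D ∧ ⌊ size D Data.Nat.≟ i ⌋))
                        (allSubsets (order G)))
  where
  open import Relation.Nullary using (Dec; yes; no)
  T? : (b : Bool) → Dec (T b)
  T? true  = yes _
  T? false = no (λ ())

Unimodal : (ℕ → ℕ) → ℕ → Set
Unimodal a N = ∃[ j ] ((∀ k → k < j → suc k ≤ N → a k ≤ a (suc k))
                     × (∀ k → j ≤ k → suc k ≤ N → a (suc k) ≤ a k))

-- D_t(G, x) is unimodal (its degree is at most |V(G)|).
TotalDomPolyUnimodal : Graph → Set
TotalDomPolyUnimodal G = Unimodal (dt G) (order G)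

-- A pendant vertex of H ∘ K̄_m is adjacent only to its root, so (for m ≥ 1) a total dominating set
-- contains every root; a set of roots and pendants is then total dominating exactly when every root
-- without a neighbour in H has at least one of its pendants chosen. Hence
--   D_t(H ∘ K̄_m, x) = x^n ∏ᵢ pᵢ(x),   pᵢ ∈ {(1 + x)^m, (1 + x)^m − 1}.
-- The coefficient sequences of x, 1 + x and (1 + x)^m − 1 are Pólya frequency sequences of order 2
-- (their Toeplitz matrices have no negative 2×2 minor); by Cauchy–Binet this class is closed under
-- products, and its members are unimodal. Every member of the family is such a corona.

module Submission where

open import Defs
open import Data.Bool using (Bool; true; false; _∧_; _∨_; if_then_else_; T)
open import Data.Bool.ListAction using (all; any)
open import Data.Bool.Properties using (∧-identityʳ; ∧-zeroʳ; T-∧; T-∨)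
open import Data.Empty using (⊥-elim)
open import Data.Fin using (Fin; zero; suc; _↑ˡ_; _↑ʳ_; combine; remQuot; splitAt)
open import Data.Fin.Properties
  using (splitAt-↑ˡ; splitAt-↑ʳ; splitAt⁻¹-↑ˡ; splitAt⁻¹-↑ʳ; remQuot-combine; combine-remQuot)
import Data.Fin.Properties as Fin
open import Data.Fin.Subset using (Subset; ∣_∣; _∈_)
open import Data.List using ([]; _∷_; map; length; filter; allFin) renaming (_++_ to _++ˡ_)
open import Data.List.Membership.Propositional using (lose)
open import Data.List.Membership.Propositional.Properties using (∈-allFin)
open import Data.List.Properties using (length-++; filter-++)
import Data.List.Relation.Unary.All as All
open import Data.List.Relation.Unary.All.Properties using (all⁺; all⁻)
open import Data.List.Relation.Unary.Any using (satisfied)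
open import Data.List.Relation.Unary.Any.Properties using (any⁺; any⁻)
open import Data.Nat
  using (ℕ; zero; suc; _+_; _*_; _∸_; _≤_; _<_; _≥_; z≤n; s≤s; _≤?_; _<?_; _≟_; _≡ᵇ_)
open import Data.Nat.Properties
open import Algebra.Properties.CommutativeSemigroup +-commutativeSemigroup using (interchange)
open import Data.Nat.Solver using (module +-*-Solver)
open import Data.Product using (_×_; _,_; ∃-syntax; proj₁; proj₂)
open import Data.Product.Function.NonDependent.Propositional using (_×-⇔_)
open import Data.Sum using (_⊎_; inj₁; inj₂)
open import Data.Vec using (Vec; []; _∷_; _++_; lookup; take; drop)
open import Data.Vec.Properties using (lookup-++ˡ; lookup-++ʳ; take++drop≡id)
open import Function using (_∘_)
open import Function.Bundles using (_⇔_; mk⇔; Equivalence)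
open import Function.Properties.Equivalence using (⇔-setoid)
open import Level using (Level; 0ℓ)
open import Relation.Binary.PropositionalEquality
import Relation.Binary.Reasoning.Setoid as ≈-Reasoning
open import Relation.Nullary using (yes; no; does)
open import Relation.Nullary.Decidable using (⌊_⌋; T?; does-⇔; isYes≗does; toWitness; fromWitness)
open import Relation.Unary using (Pred; Decidable)
open +-*-Solver

private
  variable
    ℓ : Level
    X Y : Set
    k : ℕ
    a b f g : ℕ → ℕ

-- Finite sums

∑< : ℕ → (ℕ → ℕ) → ℕ
∑< zero    f = 0
∑< (suc B) f = ∑< B f + f B

syntax ∑< B (λ y → e) = ∑[ y < B ] e

∑-cong : ∀ B → (∀ y → y < B → f y ≡ g y) → ∑< B f ≡ ∑< B g
∑-cong zero    _   = refl
∑-cong (suc B) f≡g = cong₂ _+_ (∑-cong B (λ y y<B → f≡g y (m<n⇒m<1+n y<B))) (f≡g B ≤-refl)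

∑-mono-≤ : ∀ B → (∀ y → y < B → f y ≤ g y) → ∑< B f ≤ ∑< B g
∑-mono-≤ zero    _   = ≤-refl
∑-mono-≤ (suc B) f≤g = +-mono-≤ (∑-mono-≤ B (λ y y<B → f≤g y (m<n⇒m<1+n y<B))) (f≤g B ≤-refl)

∑-zero : ∀ B → (∀ y → y < B → f y ≡ 0) → ∑< B f ≡ 0
∑-zero zero    _   = refl
∑-zero (suc B) f≡0 = cong₂ _+_ (∑-zero B (λ y y<B → f≡0 y (m<n⇒m<1+n y<B))) (f≡0 B ≤-refl)

∑-distrib-+ : ∀ B f g → ∑[ y < B ] (f y + g y) ≡ ∑< B f + ∑< B g
∑-distrib-+ zero    f g = refl
∑-distrib-+ (suc B) f g =
  trans (cong (_+ (f B + g B)) (∑-distrib-+ B f g)) (interchange (∑< B f) (∑< B g) (f B) (g B))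

∑-distribˡ-* : ∀ B c f → ∑[ y < B ] (c * f y) ≡ c * ∑< B f
∑-distribˡ-* zero    c f = sym (*-zeroʳ c)
∑-distribˡ-* (suc B) c f =
  trans (cong (_+ c * f B) (∑-distribˡ-* B c f)) (sym (*-distribˡ-+ c (∑< B f) (f B)))

∑-distribʳ-* : ∀ B c f → ∑[ y < B ] (f y * c) ≡ ∑< B f * c
∑-distribʳ-* B c f = begin
  ∑[ y < B ] (f y * c) ≡⟨ ∑-cong B (λ y _ → *-comm (f y) c) ⟩
  ∑[ y < B ] (c * f y) ≡⟨ ∑-distribˡ-* B c f ⟩
  c * ∑< B f           ≡⟨ *-comm c (∑< B f) ⟩
  ∑< B f * c           ∎
  where open ≡-Reasoning

∑-*-∑ : ∀ B C f g → ∑< B f * ∑< C g ≡ ∑[ y < B ] ∑[ z < C ] (f y * g z)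
∑-*-∑ B C f g =
  trans (sym (∑-distribʳ-* B (∑< C g) f)) (∑-cong B (λ y _ → sym (∑-distribˡ-* C (f y) g)))

∑-comm : ∀ B C (h : ℕ → ℕ → ℕ) → ∑[ y < B ] ∑[ z < C ] h y z ≡ ∑[ z < C ] ∑[ y < B ] h y z
∑-comm zero    C h = sym (∑-zero C (λ _ _ → refl))
∑-comm (suc B) C h = trans (cong (_+ ∑< C (h B)) (∑-comm B C h)) (sym (∑-distrib-+ C _ (h B)))

∑-suc : ∀ B f → ∑< (suc B) f ≡ f 0 + ∑[ y < B ] f (suc y)
∑-suc zero    f = +-comm 0 (f 0)
∑-suc (suc B) f = trans (cong (_+ f (suc B)) (∑-suc B f)) (+-assoc (f 0) _ _)

∑-vanishing-tail : ∀ k B → (∀ y → B ≤ y → f y ≡ 0) → ∑< (k + B) f ≡ ∑< B f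
∑-vanishing-tail zero    B _   = refl
∑-vanishing-tail (suc k) B f≡0 =
  trans (cong₂ _+_ (∑-vanishing-tail k B f≡0) (f≡0 (k + B) (m≤n+m B k))) (+-identityʳ _)

-- Swapping the summation order pairs each term h y z with its mirror h z y.
∑∑-mono-≤-symmetrised : ∀ B (h k : ℕ → ℕ → ℕ) → (∀ y z → h y z + h z y ≤ k y z + k z y) →
                        ∑[ y < B ] ∑[ z < B ] h y z ≤ ∑[ y < B ] ∑[ z < B ] k y z
∑∑-mono-≤-symmetrised B h k hk = halve (begin
  H + H                                      ≡⟨ cong (H +_) (∑-comm B B h) ⟩
  H + ∑[ z < B ] ∑[ y < B ] h y z            ≡⟨ sym (∑-distrib-+ B _ _) ⟩
  ∑[ y < B ] (∑< B (h y) + ∑[ z < B ] h z y)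
    ≡⟨ ∑-cong B (λ y _ → sym (∑-distrib-+ B _ _)) ⟩
  ∑[ y < B ] ∑[ z < B ] (h y z + h z y)
    ≤⟨ ∑-mono-≤ B (λ y _ → ∑-mono-≤ B (λ z _ → hk y z)) ⟩
  ∑[ y < B ] ∑[ z < B ] (k y z + k z y)      ≡⟨ ∑-cong B (λ y _ → ∑-distrib-+ B _ _) ⟩
  ∑[ y < B ] (∑< B (k y) + ∑[ z < B ] k z y) ≡⟨ ∑-distrib-+ B _ _ ⟩
  K + ∑[ z < B ] ∑[ y < B ] k y z            ≡⟨ cong (K +_) (sym (∑-comm B B k)) ⟩
  K + K                                      ∎)
  where
  open ≤-Reasoning
  H = ∑[ y < B ] ∑[ z < B ] h y z
  K = ∑[ y < B ] ∑[ z < B ] k y z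
  halve : ∀ {a b} → a + a ≤ b + b → a ≤ b
  halve {a} {b} a+a≤b+b with a ≤? b
  ... | yes a≤b = a≤b
  ... | no  a≰b = ⊥-elim (<⇒≱ (+-mono-< (≰⇒> a≰b) (≰⇒> a≰b)) a+a≤b+b)

-- Pólya frequency sequences

-- Sequences ℕ → ℕ stand for coefficient sequences of polynomials, and _⊛_ for their product.
δ : ℕ → ℕ
δ zero    = 1
δ (suc _) = 0

1+x : ℕ → ℕ
1+x zero          = 1
1+x (suc zero)    = 1
1+x (suc (suc _)) = 0

mulX : (ℕ → ℕ) → ℕ → ℕ
mulX a zero    = 0
mulX a (suc k) = a k

dropConstant : (ℕ → ℕ) → ℕ → ℕ
dropConstant a zero    = 0
dropConstant a (suc k) = a (suc k)

_⊛_ : (ℕ → ℕ) → (ℕ → ℕ) → ℕ → ℕ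
(a ⊛ b) k = ∑[ y < suc k ] (a (k ∸ y) * b y)

toeplitz : (ℕ → ℕ) → ℕ → ℕ → ℕ
toeplitz a x       zero    = a x
toeplitz a zero    (suc y) = 0
toeplitz a (suc x) (suc y) = toeplitz a x y

-- Pólya frequency of order 2: all 2×2 minors of the Toeplitz matrix (a (x − y)) are nonnegative,
-- i.e. a is log-concave with no internal zeros.
PF₂ : (ℕ → ℕ) → Set
PF₂ a = ∀ x₁ x₂ y₁ y₂ → x₁ ≤ x₂ → y₁ ≤ y₂ →
        toeplitz a x₁ y₂ * toeplitz a x₂ y₁ ≤ toeplitz a x₁ y₁ * toeplitz a x₂ y₂

toeplitz-below : ∀ a x y → y ≤ x → toeplitz a x y ≡ a (x ∸ y)
toeplitz-below a x       zero    _         = refl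
toeplitz-below a (suc x) (suc y) (s≤s y≤x) = toeplitz-below a x y y≤x

toeplitz-above : ∀ a x y → x < y → toeplitz a x y ≡ 0
toeplitz-above a zero    (suc y) _         = refl
toeplitz-above a (suc x) (suc y) (s≤s x<y) = toeplitz-above a x y x<y

toeplitz-cong : a ≗ b → ∀ x y → toeplitz a x y ≡ toeplitz b x y
toeplitz-cong a≗b x       zero    = a≗b x
toeplitz-cong a≗b zero    (suc y) = refl
toeplitz-cong a≗b (suc x) (suc y) = toeplitz-cong a≗b x y

PF₂-resp-≗ : a ≗ b → PF₂ a → PF₂ b
PF₂-resp-≗ a≗b pf x₁ x₂ y₁ y₂ x₁≤x₂ y₁≤y₂ =
  subst₂ _≤_ (cong₂ _*_ (toeplitz-cong a≗b x₁ y₂) (toeplitz-cong a≗b x₂ y₁))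
             (cong₂ _*_ (toeplitz-cong a≗b x₁ y₁) (toeplitz-cong a≗b x₂ y₂))
             (pf x₁ x₂ y₁ y₂ x₁≤x₂ y₁≤y₂)

toeplitz-⊛ : ∀ a b x w B → x < B → ∑[ y < B ] (toeplitz a x y * toeplitz b y w) ≡ toeplitz (a ⊛ b) x w
toeplitz-⊛ a b x zero B x<B = begin
  ∑[ y < B ] (toeplitz a x y * b y)
    ≡⟨ cong (λ B′ → ∑[ y < B′ ] (toeplitz a x y * b y)) (sym (m∸n+n≡m x<B)) ⟩
  ∑[ y < B ∸ suc x + suc x ] (toeplitz a x y * b y)
    ≡⟨ ∑-vanishing-tail (B ∸ suc x) (suc x) (λ y x<y → cong (_* b y) (toeplitz-above a x y x<y)) ⟩
  ∑[ y < suc x ] (toeplitz a x y * b y)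
    ≡⟨ ∑-cong (suc x) (λ y y≤x → cong (_* b y) (toeplitz-below a x y (≤-pred y≤x))) ⟩
  (a ⊛ b) x ∎
  where open ≡-Reasoning
toeplitz-⊛ a b zero (suc w) B _ = ∑-zero B λ { zero _ → *-zeroʳ (a zero) ; (suc y) _ → refl }
toeplitz-⊛ a b (suc x) (suc w) (suc B) (s≤s x<B) = begin
  ∑[ y < suc B ] (toeplitz a (suc x) y * toeplitz b y (suc w))
    ≡⟨ ∑-suc B (λ y → toeplitz a (suc x) y * toeplitz b y (suc w)) ⟩
  a (suc x) * 0 + ∑[ y < B ] (toeplitz a x y * toeplitz b y w)
    ≡⟨ cong (_+ ∑[ y < B ] (toeplitz a x y * toeplitz b y w)) (*-zeroʳ (a (suc x))) ⟩
  ∑[ y < B ] (toeplitz a x y * toeplitz b y w)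
    ≡⟨ toeplitz-⊛ a b x w B x<B ⟩
  toeplitz (a ⊛ b) x w ∎
  where open ≡-Reasoning

rearrangement : ∀ α β p q → β ≤ α → q ≤ p → α * q + β * p ≤ α * p + β * q
rearrangement α β p q β≤α q≤p =
  subst₂ (λ α p → α * q + β * p ≤ α * p + β * q) (m+[n∸m]≡n β≤α) (m+[n∸m]≡n q≤p)
    (subst ((β + e) * q + β * (q + d) ≤_) (sym (expand β e q d)) (m≤m+n _ (e * d)))
  where
  e = α ∸ β
  d = p ∸ q
  expand : ∀ β e q f → (β + e) * (q + f) + β * q ≡ ((β + e) * q + β * (q + f)) + e * f
  expand = solve 4 (λ β e q f → (β :+ e) :* (q :+ f) :+ β :* q
                               := ((β :+ e) :* q :+ β :* (q :+ f)) :+ e :* f) refl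

-- (a₁ b₂ − b₁ a₂)(c₁ d₂ − c₂ d₁) ≥ 0, expanded.
product-of-minors-≤ : ∀ a₁ a₂ b₁ b₂ c₁ c₂ d₁ d₂ → b₁ * a₂ ≤ a₁ * b₂ → c₂ * d₁ ≤ c₁ * d₂ →
                      (a₁ * c₂) * (b₂ * d₁) + (b₁ * d₂) * (a₂ * c₁)
                        ≤ (a₁ * c₁) * (b₂ * d₂) + (b₁ * d₁) * (a₂ * c₂)
product-of-minors-≤ a₁ a₂ b₁ b₂ c₁ c₂ d₁ d₂ minor₁ minor₂ =
  subst₂ _≤_ (sym (lhs a₁ a₂ b₁ b₂ c₁ c₂ d₁ d₂)) (sym (rhs a₁ a₂ b₁ b₂ c₁ c₂ d₁ d₂))
    (rearrangement (a₁ * b₂) (b₁ * a₂) (c₁ * d₂) (c₂ * d₁) minor₁ minor₂)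
  where
  lhs = solve 8 (λ a₁ a₂ b₁ b₂ c₁ c₂ d₁ d₂ →
                   (a₁ :* c₂) :* (b₂ :* d₁) :+ (b₁ :* d₂) :* (a₂ :* c₁)
                := (a₁ :* b₂) :* (c₂ :* d₁) :+ (b₁ :* a₂) :* (c₁ :* d₂)) refl
  rhs = solve 8 (λ a₁ a₂ b₁ b₂ c₁ c₂ d₁ d₂ →
                   (a₁ :* c₁) :* (b₂ :* d₂) :+ (b₁ :* d₁) :* (a₂ :* c₂)
                := (a₁ :* b₂) :* (c₁ :* d₂) :+ (b₁ :* a₂) :* (c₂ :* d₁)) refl

-- Cauchy–Binet for 2×2 minors of the product of the Toeplitz matrices of a and b.
⊛-PF₂ : PF₂ a → PF₂ b → PF₂ (a ⊛ b)
⊛-PF₂ {a} {b} pfa pfb x₁ x₂ w₁ w₂ x₁≤x₂ w₁≤w₂ = begin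
  toeplitz (a ⊛ b) x₁ w₂ * toeplitz (a ⊛ b) x₂ w₁
    ≡⟨ cong₂ _*_ (toeplitz-⊛ a b x₁ w₂ B (s≤s x₁≤x₂)) (toeplitz-⊛ a b x₂ w₁ B ≤-refl) ⟨
  ∑[ y < B ] (K₁ y * L y w₂) * ∑[ z < B ] (K₂ z * L z w₁)
    ≡⟨ ∑-*-∑ B B _ _ ⟩
  ∑[ y < B ] ∑[ z < B ] term w₂ w₁ y z
    ≤⟨ ∑∑-mono-≤-symmetrised B _ _ mirror-pair-≤ ⟩
  ∑[ y < B ] ∑[ z < B ] term w₁ w₂ y z
    ≡⟨ sym (∑-*-∑ B B _ _) ⟩
  ∑[ y < B ] (K₁ y * L y w₁) * ∑[ z < B ] (K₂ z * L z w₂)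
    ≡⟨ cong₂ _*_ (toeplitz-⊛ a b x₁ w₁ B (s≤s x₁≤x₂)) (toeplitz-⊛ a b x₂ w₂ B ≤-refl) ⟩
  toeplitz (a ⊛ b) x₁ w₁ * toeplitz (a ⊛ b) x₂ w₂ ∎
  where
  open ≤-Reasoning
  B = suc x₂
  K₁ = toeplitz a x₁
  K₂ = toeplitz a x₂
  L = toeplitz b
  term : ℕ → ℕ → ℕ → ℕ → ℕ
  term u v y z = (K₁ y * L y u) * (K₂ z * L z v)
  ordered-pair-≤ : ∀ y z → y ≤ z →
                   term w₂ w₁ y z + term w₂ w₁ z y ≤ term w₁ w₂ y z + term w₁ w₂ z y
  ordered-pair-≤ y z y≤z =
    product-of-minors-≤ (K₁ y) (K₂ y) (K₁ z) (K₂ z) (L y w₁) (L y w₂) (L z w₁) (L z w₂)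
      (pfa x₁ x₂ y z x₁≤x₂ y≤z) (pfb y z w₁ w₂ y≤z w₁≤w₂)
  mirror-pair-≤ : ∀ y z → term w₂ w₁ y z + term w₂ w₁ z y ≤ term w₁ w₂ y z + term w₁ w₂ z y
  mirror-pair-≤ y z with ≤-total y z
  ... | inj₁ y≤z = ordered-pair-≤ y z y≤z
  ... | inj₂ z≤y =
    subst₂ _≤_ (+-comm (term w₂ w₁ z y) _) (+-comm (term w₁ w₂ z y) _) (ordered-pair-≤ z y z≤y)

PF₂-δ : PF₂ δ
PF₂-δ zero     _        zero     zero     _         _         = ≤-refl
PF₂-δ zero     _        _        (suc y₂) _         _         = z≤n
PF₂-δ (suc x₁) (suc x₂) zero     y₂       _         _         =
  ≤-reflexive (*-zeroʳ (toeplitz δ (suc x₁) y₂))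
PF₂-δ (suc x₁) (suc x₂) (suc y₁) (suc y₂) (s≤s x₁≤x₂) (s≤s y₁≤y₂) =
  PF₂-δ x₁ x₂ y₁ y₂ x₁≤x₂ y₁≤y₂

PF₂-1+x : PF₂ 1+x
PF₂-1+x zero           _              zero     zero     _         _         = ≤-refl
PF₂-1+x zero           _              _        (suc y₂) _         _         = z≤n
PF₂-1+x (suc x₁)       (suc (suc x₂)) zero     y₂       _         _         =
  ≤-trans (≤-reflexive (*-zeroʳ (toeplitz 1+x (suc x₁) y₂))) z≤n
PF₂-1+x (suc zero)     (suc zero)     zero     y₂       _         _         =
  ≤-reflexive (*-comm (toeplitz 1+x 1 y₂) 1)
PF₂-1+x (suc x₁)       (suc x₂)       (suc y₁) (suc y₂) (s≤s x₁≤x₂) (s≤s y₁≤y₂) =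
  PF₂-1+x x₁ x₂ y₁ y₂ x₁≤x₂ y₁≤y₂

toeplitz-dropConstant-below : ∀ a x y → y < x → toeplitz (dropConstant a) x y ≡ toeplitz a x y
toeplitz-dropConstant-below a (suc x) zero    _         = refl
toeplitz-dropConstant-below a (suc x) (suc y) (s≤s y<x) = toeplitz-dropConstant-below a x y y<x

toeplitz-dropConstant-above : ∀ a x y → x ≤ y → toeplitz (dropConstant a) x y ≡ 0
toeplitz-dropConstant-above a zero    zero    _         = refl
toeplitz-dropConstant-above a zero    (suc y) _         = refl
toeplitz-dropConstant-above a (suc x) (suc y) (s≤s x≤y) = toeplitz-dropConstant-above a x y x≤y

PF₂-dropConstant : PF₂ a → PF₂ (dropConstant a)
PF₂-dropConstant {a} pf x₁ x₂ y₁ y₂ x₁≤x₂ y₁≤y₂ with y₂ <? x₁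
... | no  y₂≮x₁ =
  ≤-trans (≤-reflexive (cong (_* toeplitz (dropConstant a) x₂ y₁)
                             (toeplitz-dropConstant-above a x₁ y₂ (≮⇒≥ y₂≮x₁)))) z≤n
... | yes y₂<x₁ =
  subst₂ _≤_
    (sym (cong₂ _*_ (toeplitz-dropConstant-below a x₁ y₂ y₂<x₁)
                    (toeplitz-dropConstant-below a x₂ y₁ (≤-<-trans y₁≤y₂ (<-≤-trans y₂<x₁ x₁≤x₂)))))
    (sym (cong₂ _*_ (toeplitz-dropConstant-below a x₁ y₁ (≤-<-trans y₁≤y₂ y₂<x₁))
                    (toeplitz-dropConstant-below a x₂ y₂ (<-≤-trans y₂<x₁ x₁≤x₂))))
    (pf x₁ x₂ y₁ y₂ x₁≤x₂ y₁≤y₂)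

⊛-distribʳ-+ : ∀ a a′ b k → ((λ j → a j + a′ j) ⊛ b) k ≡ (a ⊛ b) k + (a′ ⊛ b) k
⊛-distribʳ-+ a a′ b k =
  trans (∑-cong (suc k) (λ y _ → *-distribʳ-+ (b y) (a (k ∸ y)) (a′ (k ∸ y))))
        (∑-distrib-+ (suc k) _ _)

mulX-⊛ : ∀ a b k → (mulX a ⊛ b) (suc k) ≡ (a ⊛ b) k
mulX-⊛ a b k = trans
  (cong₂ _+_ (∑-cong (suc k) (λ y y≤k → cong (λ i → mulX a i * b y) (+-∸-assoc 1 (≤-pred y≤k))))
             (cong (λ i → mulX a i * b (suc k)) (n∸n≡0 k)))
  (+-identityʳ ((a ⊛ b) k))

⊛-constantˡ : ∀ a b k → (∀ i → a (suc i) ≡ 0) → (a ⊛ b) k ≡ a 0 * b k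
⊛-constantˡ a b k a≡0 = cong₂ _+_ (∑-zero k vanishes) (cong (λ i → a i * b k) (n∸n≡0 k))
  where
  vanishes : ∀ y → y < k → a (k ∸ y) * b y ≡ 0
  vanishes y y<k with k ∸ y | m<n⇒0<n∸m y<k
  ... | suc i | _ = cong (_* b y) (a≡0 i)

PF₂-cross-≤ : PF₂ a → ∀ i j → i ≤ j → a i * a (suc j) ≤ a (suc i) * a j
PF₂-cross-≤ pf i j i≤j = pf (suc i) (suc j) 0 1 (s≤s i≤j) z≤n

PF₂-descent-persists : PF₂ a → ∀ i k → a (suc i) < a i → i ≤ k → a (suc k) ≤ a k
PF₂-descent-persists {a} pf i k descent i≤k with a (suc k) ≤? a k
... | yes stays = stays
... | no  rises = ⊥-elim (<⇒≱ cross-< (PF₂-cross-≤ pf i k i≤k))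
  where
  ascent : a k < a (suc k)
  ascent = ≰⇒> rises
  cross-< : a (suc i) * a k < a i * a (suc k)
  cross-< = ≤-<-trans (*-monoʳ-≤ (a (suc i)) (<⇒≤ ascent)) (*-monoˡ-<′ descent ascent)
    where
    *-monoˡ-<′ : ∀ {u v w z} → u < v → z < w → u * w < v * w
    *-monoˡ-<′ {w = suc w} u<v _ = *-monoˡ-< (suc w) u<v

first-descent : ∀ (a : ℕ → ℕ) N → (∀ k → k < N → a k ≤ a (suc k)) ⊎
                ∃[ i ] (a (suc i) < a i × (∀ k → k < i → a k ≤ a (suc k)))
first-descent a zero = inj₁ (λ k ())
first-descent a (suc N) with first-descent a N
... | inj₂ descent = inj₂ descent
... | inj₁ ascending with a N ≤? a (suc N)
...   | no  falls = inj₂ (N , ≰⇒> falls , ascending)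
...   | yes rises = inj₁ ascending′
  where
  ascending′ : ∀ k → k < suc N → a k ≤ a (suc k)
  ascending′ k (s≤s k≤N) with m≤n⇒m<n∨m≡n k≤N
  ... | inj₁ k<N  = ascending k k<N
  ... | inj₂ refl = rises

PF₂⇒Unimodal : PF₂ a → ∀ N → Unimodal a N
PF₂⇒Unimodal {a} pf N with first-descent a N
... | inj₁ ascending =
  N , (λ k k<N _ → ascending k k<N) , (λ k N≤k k<N → ⊥-elim (<⇒≱ k<N N≤k))
... | inj₂ (i , descent , ascending) =
  i , (λ k k<i _ → ascending k k<i) , (λ k i≤k _ → PF₂-descent-persists pf i k descent i≤k)

-- Counting subsets by size

count : ∀ N → (Vec Bool N → Bool) → ℕ → ℕ
count zero    P zero    = if P [] then 1 else 0
count zero    P (suc _) = 0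
count (suc N) P i       = mulX (count N (P ∘ (true ∷_))) i + count N (P ∘ (false ∷_)) i

count-congˢ : ∀ N i {P Q : Vec Bool N → Bool} → (∀ D → size D ≡ i → P D ≡ Q D) →
              count N P i ≡ count N Q i
count-congˢ zero    zero    P≡Q = cong (if_then 1 else 0) (P≡Q [] refl)
count-congˢ zero    (suc i) P≡Q = refl
count-congˢ (suc N) zero    P≡Q = count-congˢ N zero (λ D → P≡Q (false ∷ D))
count-congˢ (suc N) (suc i) P≡Q =
  cong₂ _+_ (count-congˢ N i (λ D size≡i → P≡Q (true ∷ D) (cong suc size≡i)))
            (count-congˢ N (suc i) (λ D → P≡Q (false ∷ D)))

count-cong : ∀ N {P Q : Vec Bool N → Bool} → (∀ D → P D ≡ Q D) → count N P ≗ count N Q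
count-cong N P≡Q i = count-congˢ N i (λ D _ → P≡Q D)

count-none : ∀ N i {P : Vec Bool N → Bool} → (∀ D → size D ≡ i → P D ≡ false) → count N P i ≡ 0
count-none zero    zero    P≡false = cong (if_then 1 else 0) (P≡false [] refl)
count-none zero    (suc i) P≡false = refl
count-none (suc N) zero    P≡false = count-none N zero (λ D → P≡false (false ∷ D))
count-none (suc N) (suc i) P≡false =
  cong₂ _+_ (count-none N i (λ D size≡i → P≡false (true ∷ D) (cong suc size≡i)))
            (count-none N (suc i) (λ D → P≡false (false ∷ D)))

count-const-∧ : ∀ N b (P : Vec Bool N → Bool) i →
                count N (λ D → b ∧ P D) i ≡ (if b then 1 else 0) * count N P i
count-const-∧ N true  P i = sym (+-identityʳ (count N P i))
count-const-∧ N false P i = count-none N i (λ _ _ → refl)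

mulX-cong : ∀ {a b} → a ≗ b → mulX a ≗ mulX b
mulX-cong a≗b zero    = refl
mulX-cong a≗b (suc k) = a≗b k

⊛-mulXˡ : ∀ a b → mulX a ⊛ b ≗ mulX (a ⊛ b)
⊛-mulXˡ a b zero    = refl
⊛-mulXˡ a b (suc k) = mulX-⊛ a b k

count-++ : ∀ p q (P : Vec Bool (p + q) → Bool) (P₁ : Vec Bool p → Bool) (P₂ : Vec Bool q → Bool) →
           (∀ xs ys → P (xs ++ ys) ≡ P₁ xs ∧ P₂ ys) → count (p + q) P ≗ count p P₁ ⊛ count q P₂
count-++ zero q P P₁ P₂ split i = begin
  count q P i                      ≡⟨ count-cong q (split []) i ⟩
  count q (λ ys → P₁ [] ∧ P₂ ys) i ≡⟨ count-const-∧ q (P₁ []) P₂ i ⟩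
  count zero P₁ 0 * count q P₂ i   ≡⟨ ⊛-constantˡ (count zero P₁) (count q P₂) i (λ _ → refl) ⟨
  (count zero P₁ ⊛ count q P₂) i   ∎
  where open ≡-Reasoning
count-++ (suc p) q P P₁ P₂ split i = begin
  mulX (count (p + q) (P ∘ (true ∷_))) i + count (p + q) (P ∘ (false ∷_)) i
    ≡⟨ cong₂ _+_ (mulX-cong (count-++ p q _ (P₁ ∘ (true ∷_)) P₂ (split ∘ (true ∷_))) i)
                 (count-++ p q _ (P₁ ∘ (false ∷_)) P₂ (split ∘ (false ∷_)) i) ⟩
  mulX (a₁ ⊛ c) i + (a₀ ⊛ c) i
    ≡⟨ cong (_+ (a₀ ⊛ c) i) (⊛-mulXˡ a₁ c i) ⟨
  (mulX a₁ ⊛ c) i + (a₀ ⊛ c) i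
    ≡⟨ ⊛-distribʳ-+ (mulX a₁) a₀ c i ⟨
  (count (suc p) P₁ ⊛ c) i ∎
  where
  open ≡-Reasoning
  a₁ = count p (P₁ ∘ (true ∷_))
  a₀ = count p (P₁ ∘ (false ∷_))
  c = count q P₂

length-filter-map : ∀ {Q : Pred Y ℓ} (Q? : Decidable Q) (h : X → Y) xs →
                    length (filter Q? (map h xs)) ≡ length (filter (Q? ∘ h) xs)
length-filter-map Q? h []       = refl
length-filter-map Q? h (x ∷ xs) with does (Q? (h x))
... | true  = cong suc (length-filter-map Q? h xs)
... | false = length-filter-map Q? h xs

length-filter-none : ∀ {Q : Pred X ℓ} (Q? : Decidable Q) xs → (∀ x → does (Q? x) ≡ false) →
                     length (filter Q? xs) ≡ 0
length-filter-none Q? []       _        = refl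
length-filter-none Q? (x ∷ xs) rejected with does (Q? x) | rejected x
... | false | _ = length-filter-none Q? xs rejected

length-filter-[_] : ∀ {Q : Pred X ℓ} (Q? : Decidable Q) x →
                    length (filter Q? (x ∷ [])) ≡ (if does (Q? x) then 1 else 0)
length-filter-[_] Q? x with does (Q? x)
... | true  = refl
... | false = refl

length-filter-allSubsets : ∀ N (P : Vec Bool N → Bool) i {Q : Pred (Vec Bool N) ℓ} (Q? : Decidable Q) →
                           (∀ D → Q D ⇔ T (P D ∧ (size D ≡ᵇ i))) →
                           length (filter Q? (allSubsets N)) ≡ count N P i
length-filter-allSubsets zero P zero Q? Q⇔P = trans (length-filter-[_] Q? [])
  (cong (if_then 1 else 0) (trans (does-⇔ (Q⇔P []) (Q? []) (T? _)) (∧-identityʳ (P []))))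
length-filter-allSubsets zero P (suc i) Q? Q⇔P = trans (length-filter-[_] Q? [])
  (cong (if_then 1 else 0) (trans (does-⇔ (Q⇔P []) (Q? []) (T? _)) (∧-zeroʳ (P []))))
length-filter-allSubsets (suc N) P i {Q} Q? Q⇔P = begin
  length (filter Q? (map (true ∷_) S ++ˡ map (false ∷_) S))
    ≡⟨ cong length (filter-++ Q? (map (true ∷_) S) (map (false ∷_) S)) ⟩
  length (filter Q? (map (true ∷_) S) ++ˡ filter Q? (map (false ∷_) S))
    ≡⟨ length-++ (filter Q? (map (true ∷_) S)) ⟩
  length (filter Q? (map (true ∷_) S)) + length (filter Q? (map (false ∷_) S))
    ≡⟨ cong₂ _+_ (length-filter-map Q? (true ∷_) S) (length-filter-map Q? (false ∷_) S) ⟩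
  length (filter (Q? ∘ (true ∷_)) S) + length (filter (Q? ∘ (false ∷_)) S)
    ≡⟨ cong₂ _+_ (true-head i (Q⇔P ∘ (true ∷_)))
                 (length-filter-allSubsets N (P ∘ (false ∷_)) i _ (Q⇔P ∘ (false ∷_))) ⟩
  count (suc N) P i ∎
  where
  open ≡-Reasoning
  S = allSubsets N
  true-head : ∀ j → (∀ D → Q (true ∷ D) ⇔ T (P (true ∷ D) ∧ (suc (size D) ≡ᵇ j))) →
               length (filter (Q? ∘ (true ∷_)) S) ≡ mulX (count N (P ∘ (true ∷_))) j
  true-head zero    Q⇔P′ = length-filter-none (Q? ∘ (true ∷_)) S λ D →
    trans (does-⇔ (Q⇔P′ D) (Q? (true ∷ D)) (T? _)) (∧-zeroʳ (P (true ∷ D)))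
  true-head (suc j) Q⇔P′ = length-filter-allSubsets N (P ∘ (true ∷_)) j (Q? ∘ (true ∷_)) Q⇔P′

dt≡count : ∀ G i → dt G i ≡ count (order G) (isTotalDominating G) i
dt≡count G i = length-filter-allSubsets (order G) (isTotalDominating G) i _ λ D →
  let ≟≡≡ᵇ = cong (isTotalDominating G D ∧_) (isYes≗does (size D ≟ i))
  in mk⇔ (subst T ≟≡≡ᵇ) (subst T (sym ≟≡≡ᵇ))

and : ∀ {k} → Vec Bool k → Bool
and []       = true
and (b ∷ bs) = b ∧ and bs

or : ∀ {k} → Vec Bool k → Bool
or []       = false
or (b ∷ bs) = b ∨ or bs

take-++ : ∀ {m k} (xs : Vec X m) (ys : Vec X k) → take m (xs ++ ys) ≡ xs
take-++ []       ys = refl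
take-++ (x ∷ xs) ys = cong (x ∷_) (take-++ xs ys)

drop-++ : ∀ {m k} (xs : Vec X m) (ys : Vec X k) → drop m (xs ++ ys) ≡ ys
drop-++ []       ys = refl
drop-++ (x ∷ xs) ys = drop-++ xs ys

pendantsCover : ∀ m n → (Fin n → Bool) → Vec Bool (n * m) → Bool
pendantsCover m zero    dominatedInBase ys = true
pendantsCover m (suc n) dominatedInBase ys =
  (dominatedInBase zero ∨ or (take m ys)) ∧ pendantsCover m n (dominatedInBase ∘ suc) (drop m ys)

count-[] : ∀ {P : Vec Bool 0 → Bool} → P [] ≡ true → δ ≗ count 0 P
count-[] P[]≡true zero    = cong (λ b → if b then 1 else 0) (sym P[]≡true)
count-[] P[]≡true (suc i) = refl

PF₂-count-and : ∀ k → PF₂ (count k and)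
PF₂-count-and zero    = PF₂-resp-≗ (count-[] refl) PF₂-δ
PF₂-count-and (suc k) =
  PF₂-resp-≗ (λ i → sym (count-++ 1 k and and and split i))
    (⊛-PF₂ (PF₂-resp-≗ single (PF₂-dropConstant PF₂-1+x)) (PF₂-count-and k))
  where
  split : ∀ xs ys → and (xs ++ ys) ≡ and xs ∧ and ys
  split (x ∷ []) ys = cong (_∧ and ys) (sym (∧-identityʳ x))
  single : dropConstant 1+x ≗ count 1 and
  single zero          = refl
  single (suc zero)    = refl
  single (suc (suc i)) = refl

PF₂-count-true : ∀ k → PF₂ (count k (λ _ → true))
PF₂-count-true zero    = PF₂-resp-≗ (count-[] refl) PF₂-δ
PF₂-count-true (suc k) =
  PF₂-resp-≗ (λ i → sym (count-++ 1 k (λ _ → true) (λ _ → true) (λ _ → true) (λ _ _ → refl) i))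
    (⊛-PF₂ (PF₂-resp-≗ single PF₂-1+x) (PF₂-count-true k))
  where
  single : 1+x ≗ count 1 (λ _ → true)
  single zero          = refl
  single (suc zero)    = refl
  single (suc (suc i)) = refl

or-size-zero : ∀ {k} (D : Vec Bool k) → size D ≡ 0 → or D ≡ false
or-size-zero []          _ = refl
or-size-zero (false ∷ D) size≡0 = or-size-zero D size≡0

or-size-suc : ∀ {k} (D : Vec Bool k) j → size D ≡ suc j → or D ≡ true
or-size-suc (true ∷ D)  j _ = refl
or-size-suc (false ∷ D) j size≡1+j = or-size-suc D j size≡1+j

PF₂-count-∨-or : ∀ k b → PF₂ (count k (λ D → b ∨ or D))
PF₂-count-∨-or k true  = PF₂-count-true k
PF₂-count-∨-or k false = PF₂-resp-≗ nonempty (PF₂-dropConstant (PF₂-count-true k))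
  where
  nonempty : dropConstant (count k (λ _ → true)) ≗ count k or
  nonempty zero    = sym (count-none k zero or-size-zero)
  nonempty (suc j) = count-congˢ k (suc j) (λ D size≡1+j → sym (or-size-suc D j size≡1+j))

PF₂-count-pendantsCover : ∀ m n f → PF₂ (count (n * m) (pendantsCover m n f))
PF₂-count-pendantsCover m zero    f = PF₂-resp-≗ (count-[] refl) PF₂-δ
PF₂-count-pendantsCover m (suc n) f =
  PF₂-resp-≗ (λ i → sym (count-++ m (n * m) _ (λ xs → f zero ∨ or xs) _ split i))
    (⊛-PF₂ (PF₂-count-∨-or m (f zero)) (PF₂-count-pendantsCover m n (f ∘ suc)))
  where
  split : ∀ xs ys → pendantsCover m (suc n) f (xs ++ ys) ≡ (f zero ∨ or xs) ∧ pendantsCover m n (f ∘ suc) ys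
  split xs ys =
    cong₂ (λ xs ys → (f zero ∨ or xs) ∧ pendantsCover m n (f ∘ suc) ys) (take-++ xs ys) (drop-++ xs ys)

-- Total dominating sets of a corona

T-⇔⇒≡ : ∀ {a b} → T a ⇔ T b → a ≡ b
T-⇔⇒≡ {true}  {true}  _   = refl
T-⇔⇒≡ {true}  {false} a⇔b = ⊥-elim (Equivalence.to a⇔b _)
T-⇔⇒≡ {false} {true}  a⇔b = ⊥-elim (Equivalence.from a⇔b _)
T-⇔⇒≡ {false} {false} _   = refl

T-all-allFin : ∀ (p : Fin k → Bool) → T (all p (allFin k)) ⇔ (∀ i → T (p i))
T-all-allFin {k} p =
  mk⇔ (λ t i → All.lookup (all⁺ p _ t) (∈-allFin i)) (λ t → all⁻ p {allFin k} (All.universal t _))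

T-any-allFin : ∀ (p : Fin k → Bool) → T (any p (allFin k)) ⇔ (∃[ i ] T (p i))
T-any-allFin {k} p =
  mk⇔ (satisfied ∘ any⁻ p (allFin k)) (λ (i , t) → any⁺ {xs = allFin k} p (lose (∈-allFin i) t))

IsTotalDominating : (G : Graph) → Vec Bool (order G) → Set
IsTotalDominating G D = ∀ v → ∃[ u ] T (lookup D u ∧ adj G v u)

T-isTotalDominating : ∀ G D → T (isTotalDominating G D) ⇔ IsTotalDominating G D
T-isTotalDominating G D = mk⇔
  (λ t v → Equivalence.to (T-any-allFin _) (Equivalence.to (T-all-allFin _) t v))
  (λ t → Equivalence.from (T-all-allFin _) (λ v → Equivalence.from (T-any-allFin _) (t v)))

T-and : ∀ (xs : Vec Bool k) → T (and xs) ⇔ (∀ i → T (lookup xs i))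
T-and xs = mk⇔ (to xs) (from xs)
  where
  to : ∀ {k} (xs : Vec Bool k) → T (and xs) → ∀ i → T (lookup xs i)
  to (x ∷ xs) t zero    = proj₁ (Equivalence.to T-∧ t)
  to (x ∷ xs) t (suc i) = to xs (proj₂ (Equivalence.to (T-∧ {x}) t)) i
  from : ∀ {k} (xs : Vec Bool k) → (∀ i → T (lookup xs i)) → T (and xs)
  from []       _ = _
  from (x ∷ xs) t = Equivalence.from T-∧ (t zero , from xs (t ∘ suc))

T-or : ∀ (xs : Vec Bool k) → T (or xs) ⇔ (∃[ i ] T (lookup xs i))
T-or xs = mk⇔ (to xs) (λ (i , t) → from xs i t)
  where
  to : ∀ {k} (xs : Vec Bool k) → T (or xs) → ∃[ i ] T (lookup xs i)
  to (x ∷ xs) t with Equivalence.to (T-∨ {x}) t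
  ... | inj₁ tx = zero , tx
  ... | inj₂ txs with to xs txs
  ...   | i , ti = suc i , ti
  from : ∀ {k} (xs : Vec Bool k) i → T (lookup xs i) → T (or xs)
  from (x ∷ xs) zero    t = Equivalence.from T-∨ (inj₁ t)
  from (x ∷ xs) (suc i) t = Equivalence.from (T-∨ {x}) (inj₂ (from xs i t))

lookup-take : ∀ m {n} (xs : Vec X (m + n)) i → lookup (take m xs) i ≡ lookup xs (i ↑ˡ n)
lookup-take m xs i =
  trans (sym (lookup-++ˡ (take m xs) (drop m xs) i)) (cong (λ ys → lookup ys (i ↑ˡ _)) (take++drop≡id m xs))

lookup-drop : ∀ m {n} (xs : Vec X (m + n)) i → lookup (drop m xs) i ≡ lookup xs (m ↑ʳ i)
lookup-drop m xs i =
  trans (sym (lookup-++ʳ (take m xs) (drop m xs) i)) (cong (λ ys → lookup ys (m ↑ʳ i)) (take++drop≡id m xs))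

PendantsCovered : ∀ m n → (Fin n → Bool) → Vec Bool (n * m) → Set
PendantsCovered m n dominatedInBase ys = ∀ i → T (dominatedInBase i) ⊎ ∃[ j ] T (lookup ys (combine i j))

T-pendantsCover : ∀ m n f ys → T (pendantsCover m n f ys) ⇔ PendantsCovered m n f ys
T-pendantsCover m n f ys = mk⇔ (to n f ys) (from n f ys)
  where
  to : ∀ n f ys → T (pendantsCover m n f ys) → PendantsCovered m n f ys
  to (suc n) f ys t zero with Equivalence.to (T-∨ {f zero}) (proj₁ (Equivalence.to T-∧ t))
  ... | inj₁ dominated = inj₁ dominated
  ... | inj₂ pendant with Equivalence.to (T-or (take m ys)) pendant
  ...   | j , tj = inj₂ (j , subst T (lookup-take m ys j) tj)
  to (suc n) f ys t (suc i)
    with to n (f ∘ suc) (drop m ys) (proj₂ (Equivalence.to (T-∧ {f zero ∨ or (take m ys)}) t)) i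
  ... | inj₁ dominated = inj₁ dominated
  ... | inj₂ (j , tj)  = inj₂ (j , subst T (lookup-drop m ys (combine i j)) tj)
  from : ∀ n f ys → PendantsCovered m n f ys → T (pendantsCover m n f ys)
  from zero    f ys _       = _
  from (suc n) f ys covered = Equivalence.from T-∧ (first , from n (f ∘ suc) (drop m ys) rest)
    where
    first : T (f zero ∨ or (take m ys))
    first with covered zero
    ... | inj₁ dominated = Equivalence.from T-∨ (inj₁ dominated)
    ... | inj₂ (j , tj)  = Equivalence.from (T-∨ {f zero})
            (inj₂ (Equivalence.from (T-or (take m ys)) (j , subst T (sym (lookup-take m ys j)) tj)))
    rest : PendantsCovered m n (f ∘ suc) (drop m ys)
    rest i with covered (suc i)
    ... | inj₁ dominated = inj₁ dominated
    ... | inj₂ (j , tj)  = inj₂ (j , subst T (sym (lookup-drop m ys (combine i j))) tj)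

hasNeighbour : (G : Graph) → Fin (order G) → Bool
hasNeighbour G v = any (adj G v) (allFin (order G))

module _ (H : Graph) (m : ℕ) where
  private
    n = order H
    C = coronaK H m

  root : Fin n → Fin (order C)
  root i = i ↑ˡ (n * m)

  pendant : Fin n → Fin m → Fin (order C)
  pendant i j = n ↑ʳ combine i j

  classify-root : ∀ i → classify n m (root i) ≡ inj₁ i
  classify-root i rewrite splitAt-↑ˡ n i (n * m) = refl

  classify-pendant : ∀ i j → classify n m (pendant i j) ≡ inj₂ (i , j)
  classify-pendant i j rewrite splitAt-↑ʳ n (n * m) (combine i j) | remQuot-combine i j = refl

  root-or-pendant : ∀ v → (∃[ i ] v ≡ root i) ⊎ (∃[ i ] ∃[ j ] v ≡ pendant i j)
  root-or-pendant v with splitAt n v in eq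
  ... | inj₁ i = inj₁ (i , sym (splitAt⁻¹-↑ˡ eq))
  ... | inj₂ k =
    inj₂ (proj₁ qr , proj₂ qr , trans (sym (splitAt⁻¹-↑ʳ eq)) (cong (n ↑ʳ_) (sym (combine-remQuot {n} m k))))
    where qr = remQuot {n} m k

  adj-root-root : ∀ i i′ → adj C (root i) (root i′) ≡ adj H i i′
  adj-root-root i i′ = cong₂ (coronaAdj (adj H)) (classify-root i) (classify-root i′)

  adj-root-pendant : ∀ i i′ j′ → adj C (root i) (pendant i′ j′) ≡ ⌊ i Fin.≟ i′ ⌋
  adj-root-pendant i i′ j′ = cong₂ (coronaAdj (adj H)) (classify-root i) (classify-pendant i′ j′)

  adj-pendant-root : ∀ i j i′ → adj C (pendant i j) (root i′) ≡ ⌊ i Fin.≟ i′ ⌋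
  adj-pendant-root i j i′ = cong₂ (coronaAdj (adj H)) (classify-pendant i j) (classify-root i′)

  adj-pendant-pendant : ∀ i j i′ j′ → adj C (pendant i j) (pendant i′ j′) ≡ false
  adj-pendant-pendant i j i′ j′ = cong₂ (coronaAdj (adj H)) (classify-pendant i j) (classify-pendant i′ j′)

  CoronaTotalDominating : Vec Bool n → Vec Bool (n * m) → Set
  CoronaTotalDominating xs ys = (∀ i → T (lookup xs i)) × PendantsCovered m n (hasNeighbour H) ys

  -- Root i is chosen because its pendant j₀ is adjacent to nothing else.
  totalDominating⇒coronaTotalDominating : Fin m → ∀ xs ys → IsTotalDominating C (xs ++ ys) →
                                          CoronaTotalDominating xs ys
  totalDominating⇒coronaTotalDominating j₀ xs ys dominated = roots , pendants
    where
    roots : ∀ i → T (lookup xs i)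
    roots i with dominated (pendant i j₀)
    ... | u , t with root-or-pendant u | Equivalence.to (T-∧ {lookup (xs ++ ys) u}) t
    ...   | inj₁ (i′ , refl) | chosen , adjacent
      rewrite toWitness (subst T (adj-pendant-root i j₀ i′) adjacent) = subst T (lookup-++ˡ xs ys i′) chosen
    ...   | inj₂ (i′ , j′ , refl) | _ , adjacent =
      ⊥-elim (subst T (adj-pendant-pendant i j₀ i′ j′) adjacent)
    pendants : PendantsCovered m n (hasNeighbour H) ys
    pendants i with dominated (root i)
    ... | u , t with root-or-pendant u | Equivalence.to (T-∧ {lookup (xs ++ ys) u}) t
    ...   | inj₁ (i′ , refl) | _ , adjacent =
      inj₁ (Equivalence.from (T-any-allFin (adj H i)) (i′ , subst T (adj-root-root i i′) adjacent))
    ...   | inj₂ (i′ , j′ , refl) | chosen , adjacent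
      rewrite toWitness (subst T (adj-root-pendant i i′ j′) adjacent) =
        inj₂ (j′ , subst T (lookup-++ʳ xs ys (combine i′ j′)) chosen)

  coronaTotalDominating⇒totalDominating : ∀ xs ys → CoronaTotalDominating xs ys →
                                          IsTotalDominating C (xs ++ ys)
  coronaTotalDominating⇒totalDominating xs ys (roots , pendants) v with root-or-pendant v
  ... | inj₂ (i , j , refl) = root i , Equivalence.from T-∧
          ( subst T (sym (lookup-++ˡ xs ys i)) (roots i)
          , subst T (sym (adj-pendant-root i j i)) (fromWitness refl))
  ... | inj₁ (i , refl) with pendants i
  ...   | inj₂ (j , tj) = pendant i j , Equivalence.from T-∧
          ( subst T (sym (lookup-++ʳ xs ys (combine i j))) tj
          , subst T (sym (adj-root-pendant i i j)) (fromWitness refl))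
  ...   | inj₁ hasNbr with Equivalence.to (T-any-allFin (adj H i)) hasNbr
  ...     | i′ , adjacent = root i′ , Equivalence.from T-∧
          ( subst T (sym (lookup-++ˡ xs ys i′)) (roots i′)
          , subst T (sym (adj-root-root i i′)) adjacent)

  isTotalDominating-corona : Fin m → ∀ xs ys →
                             isTotalDominating C (xs ++ ys) ≡ and xs ∧ pendantsCover m n (hasNeighbour H) ys
  isTotalDominating-corona j₀ xs ys = T-⇔⇒≡ (begin
    T (isTotalDominating C (xs ++ ys))
      ≈⟨ T-isTotalDominating C (xs ++ ys) ⟩
    IsTotalDominating C (xs ++ ys)
      ≈⟨ mk⇔ (totalDominating⇒coronaTotalDominating j₀ xs ys) (coronaTotalDominating⇒totalDominating xs ys) ⟩
    CoronaTotalDominating xs ys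
      ≈⟨ T-and xs ×-⇔ T-pendantsCover m n (hasNeighbour H) ys ⟨
    (T (and xs) × T (pendantsCover m n (hasNeighbour H) ys))
      ≈⟨ T-∧ ⟨
    T (and xs ∧ pendantsCover m n (hasNeighbour H) ys) ∎)
    where open ≈-Reasoning (⇔-setoid 0ℓ)

PF₂-dt-corona : ∀ H {m} → 1 ≤ m → PF₂ (dt (coronaK H m))
PF₂-dt-corona H {suc m} _ = PF₂-resp-≗ factorisation
  (⊛-PF₂ (PF₂-count-and n) (PF₂-count-pendantsCover (suc m) n (hasNeighbour H)))
  where
  n = order H
  C = coronaK H (suc m)
  factorisation : count n and ⊛ count (n * suc m) (pendantsCover (suc m) n (hasNeighbour H)) ≗ dt C
  factorisation i = sym (begin
    dt C i
      ≡⟨ dt≡count C i ⟩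
    count (n + n * suc m) (isTotalDominating C) i
      ≡⟨ count-++ n (n * suc m) _ and _ (isTotalDominating-corona H (suc m) zero) i ⟩
    (count n and ⊛ count (n * suc m) (pendantsCover (suc m) n (hasNeighbour H))) i ∎)
    where open ≡-Reasoning

mainTheorem8 : (G : Graph) → IsSimple G → (r : ℕ) → (I : Subset (order G)) →
                 (∀ v → v ∈ I → IsIsolated G v) → (∀ v → IsIsolated G v → v ∈ I) →
                 ∣ I ∣ ≡ r → (m : ℕ) → m ≥ 1 → (t : ℕ) →
                 TotalDomPolyUnimodal (iterCorona G m (suc t))
mainTheorem8 G _ _ _ _ _ _ m m≥1 t = PF₂⇒Unimodal (PF₂-dt-corona (iterCorona G m t) m≥1) _
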